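{- Let $n\ge 1$ and let $w$ be chosen uniformly at random from the set $\mathcal{W}(n,n,n)$ of words in the alphabet $\{1,2,3\}$ containing exactly $n$ copies of each letter. Define the random variables $s_1(w)=|\{(i,j): i<j,\ w_i=2,\ w_j=1\}|-|\{(i,j): i<j,\ w_i=1,\ w_j=2\}|$, $s_2(w)=|\{(i,j): i<j,\ w_i=3,\ w_j=2\}|-|\{(i,j): i<j,\ w_i=2,\ w_j=3\}|$, $s_3(w)=|\{(i,j): i<j,\ w_i=1,\ w_j=3\}|-|\{(i,j): i<j,\ w_i=3,\ w_j=1\}|$. Then for any two distinct $k,l\in\{1,2,3\}$, the covariance of $s_k$ and $s_l$ equals $-\frac{n^3}{3}$. -}

module Defs where

import Data.Nat as ℕ
open ℕ using (ℕ; zero; suc; _^_)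
open import Data.Integer as ℤ using (ℤ; +_)
open import Data.Rational as ℚ using (ℚ; 0ℚ)
open import Data.Fin using (Fin; zero; suc)
open import Data.Fin.Properties using (_≟_)
open import Data.List using (List; []; _∷_; map; concatMap; filter; length; foldr)
open import Data.Product using (_×_)
open import Relation.Nullary.Decidable using (does; _×-dec_)
open import Data.Bool using (if_then_else_)
open import Relation.Binary.PropositionalEquality using (_≡_)

Letter : Set
Letter = Fin 3

Word : Set
Word = List Letter

l1 l2 l3 : Letter
l1 = zero
l2 = suc zero
l3 = suc (suc zero)

allLetters : List Letter
allLetters = l1 ∷ l2 ∷ l3 ∷ []

allWords : ℕ → List Word
allWords zero    = [] ∷ []
allWords (suc m) = concatMap (λ a → map (a ∷_) (allWords m)) allLetters

count : Letter → Word → ℕ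
count a []      = 0
count a (x ∷ w) = if does (x ≟ a) then suc (count a w) else count a w

W : ℕ → List Word
W n = filter (λ w → ((count l1 w ℕ.≟ n) ×-dec (count l2 w ℕ.≟ n)) ×-dec (count l3 w ℕ.≟ n))
             (allWords (3 ℕ.* n))

pairCount : Letter → Letter → Word → ℕ
pairCount a b []      = 0
pairCount a b (x ∷ w) = (if does (x ≟ a) then count b w else 0) ℕ.+ pairCount a b w


diffCount : Letter → Letter → Word → ℤ
diffCount a b w = + pairCount a b w ℤ.- + pairCount b a w

-- s k for k = zero, suc zero, suc (suc zero) is s_1, s_2, s_3 of the paper
s : Fin 3 → Word → ℤ
s zero             = diffCount l2 l1
s (suc zero)       = diffCount l3 l2
s (suc (suc zero)) = diffCount l1 l3

toℚ : ℤ → ℚ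
toℚ z = z ℚ./ 1

sumℚ : List ℚ → ℚ
sumℚ = foldr ℚ._+_ 0ℚ

-- mean of a list of values (uniform distribution on the list); 0 for empty list
mean : List ℚ → ℚ
mean []       = 0ℚ
mean (x ∷ xs) = sumℚ (x ∷ xs) ℚ.* (+ 1 ℚ./ length (x ∷ xs))

E : {A : Set} → List A → (A → ℚ) → ℚ
E L f = mean (map f L)

Cov : {A : Set} → List A → (A → ℚ) → (A → ℚ) → ℚ
Cov L f g = E L (λ x → f x ℚ.* g x) ℚ.- (E L f ℚ.* E L g)

-- Group the words of length m by their content κ = (a, b, c), the multiplicities of the three
-- letters; such a class has m! / κ! words. Deleting the first letter x maps the class of κ onto
-- that of κ − e_x, and each s_k changes by a linear function of the content of the remaining
-- word. Hence the average Q(κ) over a class of a statistic h satisfies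
--   Σ_x κ_x R_x(κ − e_x) = |κ| Q(κ),   where R_x is the average of w ↦ h(x w).
-- By induction on m, s_k averages to 0 on every class, and so the cross terms in
-- s_k(x w) s_l(x w) average to 0 as well; the recurrence for 3 s_k s_l (k ≠ l) then becomes a
-- polynomial identity, which shows that its average is −abc. At κ = (n, n, n) this is −n³.

module Submission where

open import Defs
open import Data.Bool using (Bool; true; false; T; _∧_; if_then_else_)
open import Data.Bool.Properties using (∧-zeroʳ; T-∧)
open import Data.Empty using (⊥-elim)
open import Data.Fin using (Fin; zero; suc)
open import Data.List using (List; []; _∷_; map; _++_; length; filter)
open import Data.List.Properties using (length-map; map-cong)
open import Data.Nat as ℕ using (ℕ; zero; suc; pred; _≡ᵇ_; _!; _^_)
import Data.Nat.Properties as ℕ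
open import Data.Rational as ℚ using (0ℚ; _/_; fromℚᵘ; toℚᵘ)
import Data.Rational.Properties as ℚ
open import Data.Rational.Unnormalised as ℚᵘ using (mkℚᵘ; *≡*)
import Data.Rational.Unnormalised.Properties as ℚᵘ
open import Data.Integer as ℤ using (ℤ; +_; 0ℤ; 1ℤ; _+_; _*_; -_; _-_)
import Data.Integer.Properties as ℤ
open import Data.Integer.Tactic.RingSolver using (solve-∀)
open import Data.Nat.Tactic.RingSolver renaming (solve-∀ to ℕ-solve-∀)
open import Data.Product using (_,_)
open import Function using (_∘_; const)
open import Function.Bundles using (Equivalence)
open import Relation.Nullary.Decidable using (does)
open import Relation.Unary using (Decidable)
open import Relation.Binary.PropositionalEquality

-- Filtered sums

module _ {A : Set} where

  ∑⟨_⟩ : (A → Bool) → (A → ℤ) → List A → ℤ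
  ∑⟨ p ⟩ g []       = 0ℤ
  ∑⟨ p ⟩ g (x ∷ xs) = if p x then g x + ∑⟨ p ⟩ g xs else ∑⟨ p ⟩ g xs

  ∑-++ : ∀ p g xs ys → ∑⟨ p ⟩ g (xs ++ ys) ≡ ∑⟨ p ⟩ g xs + ∑⟨ p ⟩ g ys
  ∑-++ p g []       ys = sym (ℤ.+-identityˡ _)
  ∑-++ p g (x ∷ xs) ys with p x
  ... | true  = trans (cong (_+_ (g x)) (∑-++ p g xs ys)) (sym (ℤ.+-assoc (g x) _ _))
  ... | false = ∑-++ p g xs ys

  ∑-cong : ∀ p g h xs → (∀ x → T (p x) → g x ≡ h x) → ∑⟨ p ⟩ g xs ≡ ∑⟨ p ⟩ h xs
  ∑-cong p g h []       g≡h = refl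
  ∑-cong p g h (x ∷ xs) g≡h with p x in px
  ... | true  = cong₂ _+_ (g≡h x (subst T (sym px) _)) (∑-cong p g h xs g≡h)
  ... | false = ∑-cong p g h xs g≡h

  ∑-congᵖ : ∀ p q g xs → (∀ x → p x ≡ q x) → ∑⟨ p ⟩ g xs ≡ ∑⟨ q ⟩ g xs
  ∑-congᵖ p q g []       p≡q = refl
  ∑-congᵖ p q g (x ∷ xs) p≡q rewrite p≡q x with q x
  ... | true  = cong (_+_ (g x)) (∑-congᵖ p q g xs p≡q)
  ... | false = ∑-congᵖ p q g xs p≡q

  ∑-none : ∀ p g xs → (∀ x → p x ≡ false) → ∑⟨ p ⟩ g xs ≡ 0ℤ
  ∑-none p g []       p≡false = refl
  ∑-none p g (x ∷ xs) p≡false rewrite p≡false x = ∑-none p g xs p≡false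

  ∑-+ : ∀ p g h xs → ∑⟨ p ⟩ (λ x → g x + h x) xs ≡ ∑⟨ p ⟩ g xs + ∑⟨ p ⟩ h xs
  ∑-+ p g h []       = refl
  ∑-+ p g h (x ∷ xs) with p x
  ... | true  = trans (cong (_+_ (g x + h x)) (∑-+ p g h xs)) (interchange (g x) (h x) _ _)
    where
    interchange : ∀ a b c d → a + b + (c + d) ≡ a + c + (b + d)
    interchange = solve-∀
  ... | false = ∑-+ p g h xs

  ∑-*ˡ : ∀ p c g xs → ∑⟨ p ⟩ (λ x → c * g x) xs ≡ c * ∑⟨ p ⟩ g xs
  ∑-*ˡ p c g []       = sym (ℤ.*-zeroʳ c)
  ∑-*ˡ p c g (x ∷ xs) with p x
  ... | true  = trans (cong (_+_ (c * g x)) (∑-*ˡ p c g xs)) (sym (ℤ.*-distribˡ-+ c _ _))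
  ... | false = ∑-*ˡ p c g xs

  ∑-filter : ∀ {P : A → Set} (P? : Decidable P) g xs →
             ∑⟨ const true ⟩ g (filter P? xs) ≡ ∑⟨ does ∘ P? ⟩ g xs
  ∑-filter P? g []       = refl
  ∑-filter P? g (x ∷ xs) with does (P? x)
  ... | true  = cong (_+_ (g x)) (∑-filter P? g xs)
  ... | false = ∑-filter P? g xs

∑-map : ∀ {A B : Set} p g (f : B → A) xs → ∑⟨ p ⟩ g (map f xs) ≡ ∑⟨ p ∘ f ⟩ (g ∘ f) xs
∑-map p g f []       = refl
∑-map p g f (x ∷ xs) with p (f x)
... | true  = cong (_+_ (g (f x))) (∑-map p g f xs)
... | false = ∑-map p g f xs

-- Words sorted by content

record Content : Set where
  constructor ⟨_,_,_⟩
  field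
    ones twos threes : ℕ

_#_ : Content → Letter → ℕ
⟨ a , _ , _ ⟩ # zero          = a
⟨ _ , b , _ ⟩ # suc zero       = b
⟨ _ , _ , c ⟩ # suc (suc zero) = c

-- Truncated at 0; every use is weighted by κ # x, which is then 0.
_⊖_ : Content → Letter → Content
⟨ a , b , c ⟩ ⊖ zero          = ⟨ pred a , b , c ⟩
⟨ a , b , c ⟩ ⊖ suc zero       = ⟨ a , pred b , c ⟩
⟨ a , b , c ⟩ ⊖ suc (suc zero) = ⟨ a , b , pred c ⟩

size : Content → ℕ
size ⟨ a , b , c ⟩ = a ℕ.+ b ℕ.+ c

_!ᶜ : Content → ℕ
⟨ a , b , c ⟩ !ᶜ = a ! ℕ.* b ! ℕ.* c !

content : Word → Content
content w = ⟨ count l1 w , count l2 w , count l3 w ⟩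

hasContent : Content → Word → Bool
hasContent ⟨ a , b , c ⟩ w = ((count l1 w ≡ᵇ a) ∧ (count l2 w ≡ᵇ b)) ∧ (count l3 w ≡ᵇ c)

hasContent⇒≡ : ∀ κ w → T (hasContent κ w) → content w ≡ κ
hasContent⇒≡ ⟨ a , b , c ⟩ w t =
  let t₁₂ , t₃ = Equivalence.to (T-∧ {(count l1 w ≡ᵇ a) ∧ (count l2 w ≡ᵇ b)}) t
      t₁ , t₂ = Equivalence.to (T-∧ {count l1 w ≡ᵇ a}) t₁₂
  in trans (cong₂ (λ p q → ⟨ p , q , count l3 w ⟩) (ℕ.≡ᵇ⇒≡ _ a t₁) (ℕ.≡ᵇ⇒≡ _ b t₂))
           (cong ⟨ a , b ,_⟩ (ℕ.≡ᵇ⇒≡ _ c t₃))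

classSum : ℕ → Content → (Word → ℤ) → ℤ
classSum m κ g = ∑⟨ hasContent κ ⟩ g (allWords m)

classSum-cong : ∀ m κ g h → (∀ w → content w ≡ κ → g w ≡ h w) → classSum m κ g ≡ classSum m κ h
classSum-cong m κ g h g≡h =
  ∑-cong (hasContent κ) g h (allWords m) (λ w t → g≡h w (hasContent⇒≡ κ w t))

sumOverLetters : (Letter → ℤ) → ℤ
sumOverLetters t = t l1 + t l2 + t l3

sumOverLetters-cong : ∀ t u → (∀ x → t x ≡ u x) → sumOverLetters t ≡ sumOverLetters u
sumOverLetters-cong t u t≡u = cong₂ _+_ (cong₂ _+_ (t≡u l1) (t≡u l2)) (t≡u l3)

∑-allWords-suc : ∀ p g m →
  ∑⟨ p ⟩ g (allWords (suc m)) ≡ sumOverLetters (λ x → ∑⟨ p ⟩ g (map (x ∷_) (allWords m)))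
∑-allWords-suc p g m = begin
  ∑⟨ p ⟩ g (M l1 ++ (M l2 ++ (M l3 ++ [])))
    ≡⟨ ∑-++ p g (M l1) _ ⟩
  S l1 + ∑⟨ p ⟩ g (M l2 ++ (M l3 ++ []))
    ≡⟨ cong (_+_ (S l1)) (∑-++ p g (M l2) _) ⟩
  S l1 + (S l2 + ∑⟨ p ⟩ g (M l3 ++ []))
    ≡⟨ cong (λ r → S l1 + (S l2 + r)) (trans (∑-++ p g (M l3) []) (ℤ.+-identityʳ _)) ⟩
  S l1 + (S l2 + S l3)
    ≡⟨ sym (ℤ.+-assoc (S l1) _ _) ⟩
  sumOverLetters S ∎
  where
  open ≡-Reasoning
  M : Letter → List Word
  M x = map (x ∷_) (allWords m)
  S : Letter → ℤ
  S x = ∑⟨ p ⟩ g (M x)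

hasContent-cons : ∀ κ x {k} → κ # x ≡ suc k → ∀ w → hasContent κ (x ∷ w) ≡ hasContent (κ ⊖ x) w
hasContent-cons ⟨ suc a , b , c ⟩ zero           refl w = refl
hasContent-cons ⟨ a , suc b , c ⟩ (suc zero)       refl w = refl
hasContent-cons ⟨ a , b , suc c ⟩ (suc (suc zero)) refl w = refl

hasContent-cons-absent : ∀ κ x → κ # x ≡ 0 → ∀ w → hasContent κ (x ∷ w) ≡ false
hasContent-cons-absent ⟨ zero , b , c ⟩ zero           refl w = refl
hasContent-cons-absent ⟨ a , zero , c ⟩ (suc zero)       refl w =
  cong (_∧ (count l3 w ≡ᵇ c)) (∧-zeroʳ _)
hasContent-cons-absent ⟨ a , b , zero ⟩ (suc (suc zero)) refl w = ∧-zeroʳ _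

!ᶜ-⊖ : ∀ κ x {k} → κ # x ≡ suc k → κ !ᶜ ≡ κ # x ℕ.* (κ ⊖ x) !ᶜ
!ᶜ-⊖ ⟨ suc a , b , c ⟩ zero           refl = first (suc a) (a !) (b !) (c !)
  where
  first : ∀ n x y z → n ℕ.* x ℕ.* y ℕ.* z ≡ n ℕ.* (x ℕ.* y ℕ.* z)
  first = ℕ-solve-∀
!ᶜ-⊖ ⟨ a , suc b , c ⟩ (suc zero)       refl = second (suc b) (a !) (b !) (c !)
  where
  second : ∀ n x y z → x ℕ.* (n ℕ.* y) ℕ.* z ≡ n ℕ.* (x ℕ.* y ℕ.* z)
  second = ℕ-solve-∀
!ᶜ-⊖ ⟨ a , b , suc c ⟩ (suc (suc zero)) refl = third (suc c) (a !) (b !) (c !)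
  where
  third : ∀ n x y z → x ℕ.* y ℕ.* (n ℕ.* z) ≡ n ℕ.* (x ℕ.* y ℕ.* z)
  third = ℕ-solve-∀

size-⊖ : ∀ κ x {k m} → κ # x ≡ suc k → size κ ≡ suc m → size (κ ⊖ x) ≡ m
size-⊖ ⟨ suc a , b , c ⟩ zero           refl eq = ℕ.suc-injective eq
size-⊖ ⟨ a , suc b , c ⟩ (suc zero)       refl eq =
  ℕ.suc-injective (trans (cong (ℕ._+ c) (sym (ℕ.+-suc a b))) eq)
size-⊖ ⟨ a , b , suc c ⟩ (suc (suc zero)) refl eq =
  ℕ.suc-injective (trans (sym (ℕ.+-suc (a ℕ.+ b) c)) eq)

∑-cons-class : ∀ κ x g xs →
  ∑⟨ hasContent κ ⟩ g (map (x ∷_) xs) * + κ !ᶜ ≡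
  + κ # x * (∑⟨ hasContent (κ ⊖ x) ⟩ (g ∘ (x ∷_)) xs * + (κ ⊖ x) !ᶜ)
∑-cons-class κ x g xs with κ # x in κx
... | zero  = cong (_* + κ !ᶜ)
  (trans (∑-map (hasContent κ) g (x ∷_) xs) (∑-none _ _ xs (hasContent-cons-absent κ x κx)))
... | suc k = begin
  ∑⟨ hasContent κ ⟩ g (map (x ∷_) xs) * + κ !ᶜ
    ≡⟨ cong₂ _*_ (trans (∑-map (hasContent κ) g (x ∷_) xs)
                        (∑-congᵖ _ _ _ xs (hasContent-cons κ x κx)))
                 (cong +_ (trans (!ᶜ-⊖ κ x κx) (cong (ℕ._* (κ ⊖ x) !ᶜ) κx))) ⟩
  S * + (suc k ℕ.* (κ ⊖ x) !ᶜ)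
    ≡⟨ cong (S *_) (ℤ.pos-* (suc k) _) ⟩
  S * (+ suc k * + (κ ⊖ x) !ᶜ)
    ≡⟨ swap S (+ suc k) _ ⟩
  + suc k * (S * + (κ ⊖ x) !ᶜ) ∎
  where
  open ≡-Reasoning
  S = ∑⟨ hasContent (κ ⊖ x) ⟩ (g ∘ (x ∷_)) xs
  swap : ∀ s n f → s * (n * f) ≡ n * (s * f)
  swap = solve-∀

classSum-suc : ∀ m κ g →
  classSum (suc m) κ g * + κ !ᶜ ≡
  sumOverLetters (λ x → + κ # x * (classSum m (κ ⊖ x) (g ∘ (x ∷_)) * + (κ ⊖ x) !ᶜ))
classSum-suc m κ g = begin
  classSum (suc m) κ g * + κ !ᶜ
    ≡⟨ cong (_* + κ !ᶜ) (∑-allWords-suc (hasContent κ) g m) ⟩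
  sumOverLetters B * + κ !ᶜ
    ≡⟨ distrib (B l1) (B l2) (B l3) (+ κ !ᶜ) ⟩
  sumOverLetters (λ x → B x * + κ !ᶜ)
    ≡⟨ sumOverLetters-cong _ _ (λ x → ∑-cons-class κ x g (allWords m)) ⟩
  sumOverLetters (λ x → + κ # x * (classSum m (κ ⊖ x) (g ∘ (x ∷_)) * + (κ ⊖ x) !ᶜ)) ∎
  where
  open ≡-Reasoning
  B : Letter → ℤ
  B x = ∑⟨ hasContent κ ⟩ g (map (x ∷_) (allWords m))
  distrib : ∀ p q r f → (p + q + r) * f ≡ p * f + q * f + r * f
  distrib = solve-∀

-- Class averages

Poly : Set
Poly = ℤ → ℤ → ℤ → ℤ

_at_ : Poly → Content → ℤ
P at ⟨ a , b , c ⟩ = P (+ a) (+ b) (+ c)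

-- The class of words of length m and content κ has m! / κ! elements, so this says
-- that the average of h over that class is P at κ.
record HasMean (h : Word → ℤ) (P : Poly) (m : ℕ) : Set where
  constructor hasMean
  field
    weighted : ∀ κ → size κ ≡ m → classSum m κ h * + κ !ᶜ ≡ P at κ * + (m !)

open HasMean

FirstLetterRecurrence : (Letter → Poly) → Poly → Set
FirstLetterRecurrence R Q = ∀ a b c →
  a * R l1 (a - 1ℤ) b c + b * R l2 a (b - 1ℤ) c + c * R l3 a b (c - 1ℤ) ≡ (a + b + c) * Q a b c

weight-cong : ∀ n {p q} → (∀ {k} → n ≡ suc k → p ≡ q) → + n * p ≡ + n * q
weight-cong zero    p≡q = refl
weight-cong (suc k) p≡q = cong (+ suc k *_) (p≡q refl)

weight-pred : ∀ a (P : ℤ → ℤ) f → + a * (P (+ pred a) * f) ≡ + a * P (+ a - 1ℤ) * f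
weight-pred zero    P f = refl
weight-pred (suc a) P f = sym (ℤ.*-assoc (+ suc a) (P (+ a)) f)

hasMean-induction : ∀ h Q (R : Letter → Poly) →
  h [] ≡ Q 0ℤ 0ℤ 0ℤ →
  FirstLetterRecurrence R Q →
  (∀ m x → HasMean h Q m → HasMean (h ∘ (x ∷_)) (R x) m) →
  ∀ m → HasMean h Q m
hasMean-induction h Q R base rec step m = hasMean (weighted-sum m)
  where
  weighted-sum : ∀ m κ → size κ ≡ m → classSum m κ h * + κ !ᶜ ≡ Q at κ * + (m !)
  weighted-sum zero ⟨ zero , zero , zero ⟩ refl = cong (_* 1ℤ) (trans (ℤ.+-identityʳ (h [])) base)
  weighted-sum (suc m) κ@(⟨ a , b , c ⟩) size≡ = begin
    classSum (suc m) κ h * + κ !ᶜ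
      ≡⟨ classSum-suc m κ h ⟩
    sumOverLetters (λ x → + κ # x * (classSum m (κ ⊖ x) (h ∘ (x ∷_)) * + (κ ⊖ x) !ᶜ))
      ≡⟨ sumOverLetters-cong _ _ (λ x → weight-cong (κ # x) λ κx →
           weighted (step m x (hasMean (weighted-sum m))) (κ ⊖ x) (size-⊖ κ x κx size≡)) ⟩
    sumOverLetters (λ x → + κ # x * (R x at (κ ⊖ x) * M))
      ≡⟨ cong₂ _+_ (cong₂ _+_ (weight-pred a (λ t → R l1 t (+ b) (+ c)) M)
                              (weight-pred b (λ t → R l2 (+ a) t (+ c)) M))
                   (weight-pred c (R l3 (+ a) (+ b)) M) ⟩
    + a * R l1 (+ a - 1ℤ) (+ b) (+ c) * M + + b * R l2 (+ a) (+ b - 1ℤ) (+ c) * M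
      + + c * R l3 (+ a) (+ b) (+ c - 1ℤ) * M
      ≡⟨ collect (+ a * _) (+ b * _) (+ c * _) M ⟩
    (+ a * R l1 (+ a - 1ℤ) (+ b) (+ c) + + b * R l2 (+ a) (+ b - 1ℤ) (+ c)
      + + c * R l3 (+ a) (+ b) (+ c - 1ℤ)) * M
      ≡⟨ cong (_* M) (rec (+ a) (+ b) (+ c)) ⟩
    (+ a + + b + + c) * Q at κ * M
      ≡⟨ cong (λ n → n * Q at κ * M)
              (sym (trans (ℤ.pos-+ (a ℕ.+ b) c) (cong (_+ + c) (ℤ.pos-+ a b)))) ⟩
    + size κ * Q at κ * M
      ≡⟨ cong (λ n → + n * Q at κ * M) size≡ ⟩
    + suc m * Q at κ * M
      ≡⟨ rearrange (+ suc m) (Q at κ) M ⟩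
    Q at κ * (+ suc m * M)
      ≡⟨ cong (Q at κ *_) (sym (ℤ.pos-* (suc m) (m !))) ⟩
    Q at κ * + (suc m !) ∎
    where
    open ≡-Reasoning
    M = + (m !)
    collect : ∀ p q r f → p * f + q * f + r * f ≡ (p + q + r) * f
    collect = solve-∀
    rearrange : ∀ n q f → n * q * f ≡ q * (n * f)
    rearrange = solve-∀

hasMean-cong : ∀ {u v P Q m} → (∀ w → u w ≡ v w) → (∀ a b c → P a b c ≡ Q a b c) →
  HasMean u P m → HasMean v Q m
weighted (hasMean-cong {u} {v} {P} {Q} {m} u≡v P≡Q H) κ@(⟨ a , b , c ⟩) size≡ =
  trans (cong (_* + κ !ᶜ) (classSum-cong m κ v u (λ w _ → sym (u≡v w))))
        (trans (weighted H κ size≡) (cong (_* + (m !)) (P≡Q (+ a) (+ b) (+ c))))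

hasMean-+ : ∀ {u v P Q m} → HasMean u P m → HasMean v Q m →
  HasMean (λ w → u w + v w) (λ a b c → P a b c + Q a b c) m
weighted (hasMean-+ {u} {v} {P} {Q} {m} Hu Hv) κ size≡ = begin
  classSum m κ (λ w → u w + v w) * + κ !ᶜ
    ≡⟨ cong (_* + κ !ᶜ) (∑-+ (hasContent κ) u v (allWords m)) ⟩
  (classSum m κ u + classSum m κ v) * + κ !ᶜ
    ≡⟨ ℤ.*-distribʳ-+ (+ κ !ᶜ) (classSum m κ u) _ ⟩
  classSum m κ u * + κ !ᶜ + classSum m κ v * + κ !ᶜ
    ≡⟨ cong₂ _+_ (weighted Hu κ size≡) (weighted Hv κ size≡) ⟩
  P at κ * + (m !) + Q at κ * + (m !)
    ≡⟨ ℤ.*-distribʳ-+ (+ (m !)) (P at κ) _ ⟨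
  (P at κ + Q at κ) * + (m !) ∎
  where open ≡-Reasoning

hasMean-scale : ∀ (c : Poly) {u P m} → HasMean u P m →
  HasMean (λ w → c at content w * u w) (λ p q r → c p q r * P p q r) m
weighted (hasMean-scale c {u} {P} {m} H) κ size≡ = begin
  classSum m κ (λ w → c at content w * u w) * + κ !ᶜ
    ≡⟨ cong (_* + κ !ᶜ) (classSum-cong m κ _ _ (λ w eq → cong (λ κ′ → c at κ′ * u w) eq)) ⟩
  classSum m κ (λ w → c at κ * u w) * + κ !ᶜ
    ≡⟨ cong (_* + κ !ᶜ) (∑-*ˡ (hasContent κ) (c at κ) u (allWords m)) ⟩
  c at κ * classSum m κ u * + κ !ᶜ
    ≡⟨ ℤ.*-assoc (c at κ) _ _ ⟩
  c at κ * (classSum m κ u * + κ !ᶜ)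
    ≡⟨ cong (c at κ *_) (weighted H κ size≡) ⟩
  c at κ * (P at κ * + (m !))
    ≡⟨ ℤ.*-assoc (c at κ) _ _ ⟨
  c at κ * P at κ * + (m !) ∎
  where open ≡-Reasoning

hasMean-one : ∀ m → HasMean (const 1ℤ) (λ _ _ _ → 1ℤ) m
hasMean-one = hasMean-induction (const 1ℤ) (λ _ _ _ → 1ℤ) (λ _ _ _ _ → 1ℤ) refl
  total (λ _ _ H → H)
  where
  total : ∀ a b c → a * 1ℤ + b * 1ℤ + c * 1ℤ ≡ (a + b + c) * 1ℤ
  total = solve-∀

multinomial : ∀ m κ → size κ ≡ m → classSum m κ (const 1ℤ) * + κ !ᶜ ≡ + (m !)
multinomial m κ size≡ = trans (weighted (hasMean-one m) κ size≡) (ℤ.*-identityˡ _)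

!ᶜ-nonZero : ∀ κ → ℕ.NonZero (κ !ᶜ)
!ᶜ-nonZero ⟨ a , b , c ⟩ =
  ℕ.m*n≢0 (a ! ℕ.* b !) (c !) {{ℕ.m*n≢0 (a !) (b !) {{a ℕ.!≢0}} {{b ℕ.!≢0}}}} {{c ℕ.!≢0}}

classSum-mean : ∀ {h P m} κ → size κ ≡ m → HasMean h P m →
  classSum m κ h ≡ P at κ * classSum m κ (const 1ℤ)
classSum-mean {h} {P} {m} κ size≡ H = ℤ.*-cancelʳ-≡ _ _ (+ κ !ᶜ) {{ !ᶜ-nonZero κ }} (begin
  classSum m κ h * + κ !ᶜ                   ≡⟨ weighted H κ size≡ ⟩
  P at κ * + (m !)                          ≡⟨ cong (P at κ *_) (multinomial m κ size≡) ⟨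
  P at κ * (classSum m κ (const 1ℤ) * + κ !ᶜ) ≡⟨ ℤ.*-assoc (P at κ) _ _ ⟨
  P at κ * classSum m κ (const 1ℤ) * + κ !ᶜ ∎)
  where open ≡-Reasoning

Increments : (Word → ℤ) → (Letter → Poly) → Set
Increments f Δ = ∀ x w → f (x ∷ w) ≡ f w + Δ x at content w

hasMean-cons : ∀ {f Δ P m} x → Increments f Δ → HasMean f P m →
  HasMean (f ∘ (x ∷_)) (λ a b c → P a b c + Δ x a b c) m
hasMean-cons {f} {Δ} {P} {m} x incr H =
  hasMean-cong (λ w → trans (cong (_+_ (f w)) (ℤ.*-identityʳ (Δ x at content w))) (sym (incr x w)))
               (λ a b c → cong (_+_ (P a b c)) (ℤ.*-identityʳ (Δ x a b c)))
               (hasMean-+ H (hasMean-scale (Δ x) (hasMean-one m)))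

hasMean-zero : ∀ f Δ → Increments f Δ → f [] ≡ 0ℤ → FirstLetterRecurrence Δ (λ _ _ _ → 0ℤ) →
  ∀ m → HasMean f (λ _ _ _ → 0ℤ) m
hasMean-zero f Δ incr base rec = hasMean-induction f _ Δ base rec
  (λ m x H → hasMean-cong (λ _ → refl) (λ a b c → ℤ.+-identityˡ _) (hasMean-cons {Δ = Δ} x incr H))

hasMean-product : ∀ d f g Δf Δg Q → Increments f Δf → Increments g Δg →
  (∀ m → HasMean f (λ _ _ _ → 0ℤ) m) → (∀ m → HasMean g (λ _ _ _ → 0ℤ) m) →
  d * (f [] * g []) ≡ Q 0ℤ 0ℤ 0ℤ →
  FirstLetterRecurrence (λ x a b c → Q a b c + d * (Δf x a b c * Δg x a b c)) Q →
  ∀ m → HasMean (λ w → d * (f w * g w)) Q m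
hasMean-product d f g Δf Δg Q incrf incrg f-mean g-mean base rec =
  hasMean-induction _ Q _ base rec step
  where
  expand : ∀ d s a t b →
    d * (s * t) + (d * b * s + (d * a * t + d * (a * b) * 1ℤ)) ≡ d * ((s + a) * (t + b))
  expand = solve-∀
  collapse : ∀ q u v k → q + (u * 0ℤ + (v * 0ℤ + k * 1ℤ)) ≡ q + k
  collapse = solve-∀
  step : ∀ m x → HasMean (λ w → d * (f w * g w)) Q m →
         HasMean (λ w → d * (f (x ∷ w) * g (x ∷ w)))
                 (λ a b c → Q a b c + d * (Δf x a b c * Δg x a b c)) m
  step m x H = hasMean-cong
    (λ w → trans (expand d (f w) (Δf x at content w) (g w) (Δg x at content w))
                 (sym (cong₂ (λ s t → d * (s * t)) (incrf x w) (incrg x w))))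
    (λ a b c → collapse (Q a b c) (d * Δg x a b c) (d * Δf x a b c) _)
    (hasMean-+ H (hasMean-+ (hasMean-scale (λ a b c → d * Δg x a b c) (f-mean m))
                 (hasMean-+ (hasMean-scale (λ a b c → d * Δf x a b c) (g-mean m))
                            (hasMean-scale (λ a b c → d * (Δf x a b c * Δg x a b c))
                                           (hasMean-one m)))))

-- The statistics s_k

Δs : Fin 3 → Letter → Poly
Δs zero             zero             a b c = - b
Δs zero             (suc zero)       a b c = a
Δs zero             (suc (suc zero)) a b c = 0ℤ
Δs (suc zero)       zero             a b c = 0ℤ
Δs (suc zero)       (suc zero)       a b c = - c
Δs (suc zero)       (suc (suc zero)) a b c = b
Δs (suc (suc zero)) zero             a b c = c
Δs (suc (suc zero)) (suc zero)       a b c = 0ℤ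
Δs (suc (suc zero)) (suc (suc zero)) a b c = - a

diff-gain : ∀ p c q → + (c ℕ.+ p) - + q ≡ (+ p - + q) + + c
diff-gain p c q = trans (cong (_- + q) (ℤ.pos-+ c p)) (rearrange (+ p) (+ c) (+ q))
  where
  rearrange : ∀ p c q → c + p - q ≡ p - q + c
  rearrange = solve-∀

diff-loss : ∀ p c q → + p - + (c ℕ.+ q) ≡ (+ p - + q) + - + c
diff-loss p c q = trans (cong (λ r → + p - r) (ℤ.pos-+ c q)) (rearrange (+ p) (+ c) (+ q))
  where
  rearrange : ∀ p c q → p - (c + q) ≡ p - q + - c
  rearrange = solve-∀

s-increments : ∀ k → Increments (s k) (Δs k)
s-increments zero             zero             w =
  diff-loss (pairCount l2 l1 w) (count l2 w) (pairCount l1 l2 w)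
s-increments zero             (suc zero)       w =
  diff-gain (pairCount l2 l1 w) (count l1 w) (pairCount l1 l2 w)
s-increments zero             (suc (suc zero)) w = sym (ℤ.+-identityʳ _)
s-increments (suc zero)       zero             w = sym (ℤ.+-identityʳ _)
s-increments (suc zero)       (suc zero)       w =
  diff-loss (pairCount l3 l2 w) (count l3 w) (pairCount l2 l3 w)
s-increments (suc zero)       (suc (suc zero)) w =
  diff-gain (pairCount l3 l2 w) (count l2 w) (pairCount l2 l3 w)
s-increments (suc (suc zero)) zero             w =
  diff-gain (pairCount l1 l3 w) (count l3 w) (pairCount l3 l1 w)
s-increments (suc (suc zero)) (suc zero)       w = sym (ℤ.+-identityʳ _)
s-increments (suc (suc zero)) (suc (suc zero)) w =
  diff-loss (pairCount l1 l3 w) (count l1 w) (pairCount l3 l1 w)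

s-empty : ∀ k → s k [] ≡ 0ℤ
s-empty zero             = refl
s-empty (suc zero)       = refl
s-empty (suc (suc zero)) = refl

s-mean : ∀ k m → HasMean (s k) (λ _ _ _ → 0ℤ) m
s-mean k = hasMean-zero (s k) (Δs k) (s-increments k) (s-empty k) (recurrence k)
  where
  recurrence : ∀ k → FirstLetterRecurrence (Δs k) (λ _ _ _ → 0ℤ)
  recurrence zero = identity
    where
    identity : ∀ a b c → a * - b + b * a + c * 0ℤ ≡ (a + b + c) * 0ℤ
    identity = solve-∀
  recurrence (suc zero) = identity
    where
    identity : ∀ a b c → a * 0ℤ + b * - c + c * b ≡ (a + b + c) * 0ℤ
    identity = solve-∀
  recurrence (suc (suc zero)) = identity
    where
    identity : ∀ a b c → a * c + b * 0ℤ + c * - a ≡ (a + b + c) * 0ℤ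
    identity = solve-∀

productMean : Poly
productMean a b c = - (a * b * c)

ProductRecurrence : Fin 3 → Fin 3 → Set
ProductRecurrence k l =
  FirstLetterRecurrence (λ x a b c → productMean a b c + + 3 * (Δs k x a b c * Δs l x a b c))
                        productMean

recurrence₁₂ : ProductRecurrence zero (suc zero)
recurrence₁₂ = identity
  where
  identity : ∀ a b c →
    a * (- ((a - 1ℤ) * b * c) + + 3 * (- b * 0ℤ)) + b * (- (a * (b - 1ℤ) * c) + + 3 * (a * - c))
      + c * (- (a * b * (c - 1ℤ)) + + 3 * (0ℤ * b)) ≡ (a + b + c) * - (a * b * c)
  identity = solve-∀

recurrence₂₃ : ProductRecurrence (suc zero) (suc (suc zero))
recurrence₂₃ = identity
  where
  identity : ∀ a b c →
    a * (- ((a - 1ℤ) * b * c) + + 3 * (0ℤ * c)) + b * (- (a * (b - 1ℤ) * c) + + 3 * (- c * 0ℤ))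
      + c * (- (a * b * (c - 1ℤ)) + + 3 * (b * - a)) ≡ (a + b + c) * - (a * b * c)
  identity = solve-∀

recurrence₃₁ : ProductRecurrence (suc (suc zero)) zero
recurrence₃₁ = identity
  where
  identity : ∀ a b c →
    a * (- ((a - 1ℤ) * b * c) + + 3 * (c * - b)) + b * (- (a * (b - 1ℤ) * c) + + 3 * (0ℤ * a))
      + c * (- (a * b * (c - 1ℤ)) + + 3 * (- a * 0ℤ)) ≡ (a + b + c) * - (a * b * c)
  identity = solve-∀

s-product-mean : ∀ k l → ProductRecurrence k l →
  ∀ m → HasMean (λ w → + 3 * (s k w * s l w)) productMean m
s-product-mean k l rec = hasMean-product (+ 3) (s k) (s l) (Δs k) (Δs l) productMean
  (s-increments k) (s-increments l) (s-mean k) (s-mean l)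
  (cong₂ (λ u v → + 3 * (u * v)) (s-empty k) (s-empty l)) rec

-- From integer sums to rational covariances

fromℚᵘ-homo-+ : ∀ p q → fromℚᵘ (p ℚᵘ.+ q) ≡ fromℚᵘ p ℚ.+ fromℚᵘ q
fromℚᵘ-homo-+ p q = ℚ.toℚᵘ-injective (begin
  toℚᵘ (fromℚᵘ (p ℚᵘ.+ q))                    ≈⟨ ℚ.toℚᵘ-fromℚᵘ (p ℚᵘ.+ q) ⟩
  p ℚᵘ.+ q                                    ≈⟨ ℚᵘ.+-cong (ℚ.toℚᵘ-fromℚᵘ p) (ℚ.toℚᵘ-fromℚᵘ q) ⟨
  toℚᵘ (fromℚᵘ p) ℚᵘ.+ toℚᵘ (fromℚᵘ q)        ≈⟨ ℚ.toℚᵘ-homo-+ (fromℚᵘ p) (fromℚᵘ q) ⟨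
  toℚᵘ (fromℚᵘ p ℚ.+ fromℚᵘ q)                ∎)
  where open ℚᵘ.≃-Reasoning

fromℚᵘ-homo-* : ∀ p q → fromℚᵘ (p ℚᵘ.* q) ≡ fromℚᵘ p ℚ.* fromℚᵘ q
fromℚᵘ-homo-* p q = ℚ.toℚᵘ-injective (begin
  toℚᵘ (fromℚᵘ (p ℚᵘ.* q))                    ≈⟨ ℚ.toℚᵘ-fromℚᵘ (p ℚᵘ.* q) ⟩
  p ℚᵘ.* q                                    ≈⟨ ℚᵘ.*-cong (ℚ.toℚᵘ-fromℚᵘ p) (ℚ.toℚᵘ-fromℚᵘ q) ⟨
  toℚᵘ (fromℚᵘ p) ℚᵘ.* toℚᵘ (fromℚᵘ q)        ≈⟨ ℚ.toℚᵘ-homo-* (fromℚᵘ p) (fromℚᵘ q) ⟨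
  toℚᵘ (fromℚᵘ p ℚ.* fromℚᵘ q)                ∎)
  where open ℚᵘ.≃-Reasoning

fromℚᵘ-homo‿- : ∀ p → fromℚᵘ (ℚᵘ.- p) ≡ ℚ.- fromℚᵘ p
fromℚᵘ-homo‿- p = ℚ.toℚᵘ-injective (begin
  toℚᵘ (fromℚᵘ (ℚᵘ.- p))    ≈⟨ ℚ.toℚᵘ-fromℚᵘ (ℚᵘ.- p) ⟩
  ℚᵘ.- p                    ≈⟨ ℚᵘ.-‿cong (ℚ.toℚᵘ-fromℚᵘ p) ⟨
  ℚᵘ.- toℚᵘ (fromℚᵘ p)      ≈⟨ ℚ.toℚᵘ-homo‿- (fromℚᵘ p) ⟨
  toℚᵘ (ℚ.- fromℚᵘ p)       ∎)
  where open ℚᵘ.≃-Reasoning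

toℚ-+ : ∀ a b → toℚ (a + b) ≡ toℚ a ℚ.+ toℚ b
toℚ-+ a b = trans (ℚ.fromℚᵘ-cong {mkℚᵘ (a + b) 0} {mkℚᵘ a 0 ℚᵘ.+ mkℚᵘ b 0} (*≡* (identity a b)))
                  (fromℚᵘ-homo-+ (mkℚᵘ a 0) (mkℚᵘ b 0))
  where
  identity : ∀ a b → (a + b) * 1ℤ ≡ (a * 1ℤ + b * 1ℤ) * 1ℤ
  identity = solve-∀

toℚ-* : ∀ a b → toℚ (a * b) ≡ toℚ a ℚ.* toℚ b
toℚ-* a b = fromℚᵘ-homo-* (mkℚᵘ a 0) (mkℚᵘ b 0)

toℚ-ratio : ∀ t k d len → + suc d * t ≡ - + k * + suc len →
  toℚ t ℚ.* (+ 1 / suc len) ≡ ℚ.- (+ k / suc d)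
toℚ-ratio t k d len eq = begin
  toℚ t ℚ.* (+ 1 / suc len)              ≡⟨ fromℚᵘ-homo-* (mkℚᵘ t 0) (mkℚᵘ (+ 1) len) ⟨
  fromℚᵘ (mkℚᵘ t 0 ℚᵘ.* mkℚᵘ (+ 1) len)  ≡⟨ ℚ.fromℚᵘ-cong {mkℚᵘ t 0 ℚᵘ.* mkℚᵘ (+ 1) len}
                                                          {ℚᵘ.- mkℚᵘ (+ k) d} (*≡* cross) ⟩
  fromℚᵘ (ℚᵘ.- mkℚᵘ (+ k) d)             ≡⟨ fromℚᵘ-homo‿- (mkℚᵘ (+ k) d) ⟩
  ℚ.- (+ k / suc d)                      ∎
  where
  open ≡-Reasoning
  commute : ∀ t s → t * 1ℤ * s ≡ s * t
  commute = solve-∀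
  cross : t * 1ℤ * + suc d ≡ - + k * + suc (len ℕ.+ 0)
  cross = trans (commute t (+ suc d))
                (trans eq (cong (λ n → - + k * + suc n) (sym (ℕ.+-identityʳ len))))

sumℚ-toℚ : ∀ {A : Set} (g : A → ℤ) xs → sumℚ (map (toℚ ∘ g) xs) ≡ toℚ (∑⟨ const true ⟩ g xs)
sumℚ-toℚ g []       = refl
sumℚ-toℚ g (x ∷ xs) = trans (cong (toℚ (g x) ℚ.+_) (sumℚ-toℚ g xs)) (sym (toℚ-+ (g x) _))

length-∑ : ∀ {A : Set} (xs : List A) → + length xs ≡ ∑⟨ const true ⟩ (const 1ℤ) xs
length-∑ []       = refl
length-∑ (x ∷ xs) = cong (_+_ 1ℤ) (length-∑ xs)

E-toℚ : ∀ {A : Set} (f : A → ℤ) x xs →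
  E (x ∷ xs) (toℚ ∘ f) ≡ toℚ (∑⟨ const true ⟩ f (x ∷ xs)) ℚ.* (+ 1 / suc (length xs))
E-toℚ f x xs =
  cong₂ ℚ._*_ (sumℚ-toℚ f (x ∷ xs)) (cong (λ n → + 1 / suc n) (length-map (toℚ ∘ f) xs))

Cov-comm : ∀ {A : Set} (xs : List A) f g → Cov xs f g ≡ Cov xs g f
Cov-comm xs f g =
  cong₂ ℚ._-_ (cong mean (map-cong (λ x → ℚ.*-comm (f x) (g x)) xs)) (ℚ.*-comm (E xs f) (E xs g))

Cov-from-sums : ∀ {A : Set} (xs : List A) (f g : A → ℤ) k d → xs ≢ [] →
  ∑⟨ const true ⟩ f xs ≡ 0ℤ → ∑⟨ const true ⟩ g xs ≡ 0ℤ →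
  + suc d * ∑⟨ const true ⟩ (λ x → f x * g x) xs ≡ - + k * + length xs →
  Cov xs (toℚ ∘ f) (toℚ ∘ g) ≡ ℚ.- (+ k / suc d)
Cov-from-sums []       f g k d xs≢[] _ _ _ = ⊥-elim (xs≢[] refl)
Cov-from-sums (x ∷ xs) f g k d _ f-sum g-sum fg-sum = begin
  E (x ∷ xs) (λ y → toℚ (f y) ℚ.* toℚ (g y)) ℚ.- E (x ∷ xs) (toℚ ∘ f) ℚ.* E (x ∷ xs) (toℚ ∘ g)
    ≡⟨ cong₂ ℚ._-_ (trans (cong mean (map-cong (λ y → sym (toℚ-* (f y) (g y))) (x ∷ xs)))
                          (E-toℚ (λ y → f y * g y) x xs))
                   (cong₂ ℚ._*_ (vanishes f f-sum) (vanishes g g-sum)) ⟩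
  toℚ (∑⟨ const true ⟩ (λ y → f y * g y) (x ∷ xs)) ℚ.* r ℚ.- 0ℚ ℚ.* 0ℚ
    ≡⟨ ℚ.+-identityʳ _ ⟩
  toℚ (∑⟨ const true ⟩ (λ y → f y * g y) (x ∷ xs)) ℚ.* r
    ≡⟨ toℚ-ratio _ k d (length xs) fg-sum ⟩
  ℚ.- (+ k / suc d) ∎
  where
  open ≡-Reasoning
  r = + 1 / suc (length xs)
  vanishes : ∀ h → ∑⟨ const true ⟩ h (x ∷ xs) ≡ 0ℤ → E (x ∷ xs) (toℚ ∘ h) ≡ 0ℚ
  vanishes h h-sum = trans (E-toℚ h x xs) (trans (cong (λ z → toℚ z ℚ.* r) h-sum) (ℚ.*-zeroˡ r))

W-classSum : ∀ n g → ∑⟨ const true ⟩ g (W n) ≡ classSum (3 ℕ.* n) ⟨ n , n , n ⟩ g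
W-classSum n g = ∑-filter _ g (allWords (3 ℕ.* n))

W-size : ∀ n → + length (W n) ≡ classSum (3 ℕ.* n) ⟨ n , n , n ⟩ (const 1ℤ)
W-size n = trans (length-∑ (W n)) (W-classSum n (const 1ℤ))

size-diagonal : ∀ n → size ⟨ n , n , n ⟩ ≡ 3 ℕ.* n
size-diagonal n = triple n
  where
  triple : ∀ n → n ℕ.+ n ℕ.+ n ≡ 3 ℕ.* n
  triple = ℕ-solve-∀

W-mean : ∀ {h P} n → HasMean h P (3 ℕ.* n) →
  ∑⟨ const true ⟩ h (W n) ≡ P (+ n) (+ n) (+ n) * + length (W n)
W-mean {h} {P} n H = begin
  ∑⟨ const true ⟩ h (W n)
    ≡⟨ W-classSum n h ⟩
  classSum (3 ℕ.* n) ⟨ n , n , n ⟩ h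
    ≡⟨ classSum-mean ⟨ n , n , n ⟩ (size-diagonal n) H ⟩
  P (+ n) (+ n) (+ n) * classSum (3 ℕ.* n) ⟨ n , n , n ⟩ (const 1ℤ)
    ≡⟨ cong (P (+ n) (+ n) (+ n) *_) (W-size n) ⟨
  P (+ n) (+ n) (+ n) * + length (W n) ∎
  where open ≡-Reasoning

W-nonempty : ∀ n → W n ≢ []
W-nonempty n W≡[] = ℕ.≢-nonZero⁻¹ ((3 ℕ.* n) !) {{ (3 ℕ.* n) ℕ.!≢0 }} (ℤ.+-injective (begin
  + ((3 ℕ.* n) !)
    ≡⟨ multinomial (3 ℕ.* n) ⟨ n , n , n ⟩ (size-diagonal n) ⟨
  classSum (3 ℕ.* n) ⟨ n , n , n ⟩ (const 1ℤ) * + ⟨ n , n , n ⟩ !ᶜ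
    ≡⟨ cong (_* + ⟨ n , n , n ⟩ !ᶜ) (W-size n) ⟨
  + length (W n) * + ⟨ n , n , n ⟩ !ᶜ
    ≡⟨ cong (λ xs → + length xs * + ⟨ n , n , n ⟩ !ᶜ) W≡[] ⟩
  0ℤ ∎))
  where open ≡-Reasoning

cube : ∀ n → + n * + n * + n ≡ + (n ^ 3)
cube n = begin
  + n * + n * + n       ≡⟨ cong (_* + n) (ℤ.pos-* n n) ⟨
  + (n ℕ.* n) * + n     ≡⟨ ℤ.pos-* (n ℕ.* n) n ⟨
  + (n ℕ.* n ℕ.* n)     ≡⟨ cong +_ (power n) ⟩
  + (n ^ 3)             ∎
  where
  open ≡-Reasoning
  power : ∀ n → n ℕ.* n ℕ.* n ≡ n ℕ.* (n ℕ.* (n ℕ.* 1))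
  power = ℕ-solve-∀

s-covariance : ∀ n k l → ProductRecurrence k l →
  Cov (W n) (toℚ ∘ s k) (toℚ ∘ s l) ≡ ℚ.- (+ (n ^ 3) / 3)
s-covariance n k l rec = Cov-from-sums (W n) (s k) (s l) (n ^ 3) 2 (W-nonempty n)
  (W-mean n (s-mean k (3 ℕ.* n))) (W-mean n (s-mean l (3 ℕ.* n)))
  (begin
    + 3 * ∑⟨ const true ⟩ (λ w → s k w * s l w) (W n)
      ≡⟨ ∑-*ˡ _ (+ 3) _ (W n) ⟨
    ∑⟨ const true ⟩ (λ w → + 3 * (s k w * s l w)) (W n)
      ≡⟨ W-mean n (s-product-mean k l rec (3 ℕ.* n)) ⟩
    - (+ n * + n * + n) * + length (W n)
      ≡⟨ cong (λ c → - c * + length (W n)) (cube n) ⟩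
    - + (n ^ 3) * + length (W n) ∎)
  where open ≡-Reasoning

mainTheorem3 : (n : ℕ) → 1 ℕ.≤ n → (k l : Fin 3) → k ≢ l →
    Cov (W n) (λ w → toℚ (s k w)) (λ w → toℚ (s l w)) ≡ ℚ.- ((+ (n ^ 3)) / 3)
mainTheorem3 n _ zero             (suc zero)       _ =
  s-covariance n zero (suc zero) recurrence₁₂
mainTheorem3 n _ (suc zero)       (suc (suc zero)) _ =
  s-covariance n (suc zero) (suc (suc zero)) recurrence₂₃
mainTheorem3 n _ (suc (suc zero)) zero             _ =
  s-covariance n (suc (suc zero)) zero recurrence₃₁
mainTheorem3 n _ (suc zero)       zero             _ =
  trans (Cov-comm (W n) _ _) (s-covariance n zero (suc zero) recurrence₁₂)
mainTheorem3 n _ (suc (suc zero)) (suc zero)       _ =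
  trans (Cov-comm (W n) _ _) (s-covariance n (suc zero) (suc (suc zero)) recurrence₂₃)
mainTheorem3 n _ zero             (suc (suc zero)) _ =
  trans (Cov-comm (W n) _ _) (s-covariance n (suc (suc zero)) zero recurrence₃₁)
mainTheorem3 n _ zero             zero             k≢l = ⊥-elim (k≢l refl)
mainTheorem3 n _ (suc zero)       (suc zero)       k≢l = ⊥-elim (k≢l refl)
mainTheorem3 n _ (suc (suc zero)) (suc (suc zero)) k≢l = ⊥-elim (k≢l refl)
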